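{- For $n\ge1$, $$T\chi^o_{\mathrm{St}_n}(q)=\sum_{\lambda\vdash n}a_1(\lambda)\cdot\mathrm{mult}(\tilde\lambda)\,(q+1)^{n-1}m_\lambda.$$
   Context: $\mathrm{St}_n$ is the star graph on $n$ vertices (one root adjacent to all other vertices, no other edges). An orientation $\gamma$ directs each edge; it is acyclic if there is no directed cycle. For a proper coloring $\kappa$, $\mathrm{asc}^\gamma(\kappa)$ is the number of edges oriented $u\to v$ with $\kappa(u)<\kappa(v)$; $\chi^\gamma_G(x;q)=\sum_\kappa q^{\mathrm{asc}^\gamma(\kappa)}x^\kappa$ with $x^\kappa=\prod_j x_j^{\#\kappa^{ -1}(j)}$; $T\chi^o_G(q)=\sum_\gamma\chi^\gamma_G(x;q)$ over acyclic orientations. $m_\lambda$ is the monomial symmetric function. For $\lambda=(\lambda_1,\dots,\lambda_\ell)$, $a_1(\lambda)$ is the number of parts equal to $1$, $\tilde\lambda=(\lambda_1,\dots,\lambda_{\ell-1})$, and $\mathrm{mult}(\beta)=\frac{|\beta|!}{\prod_m\beta_m!}$ with $\mathrm{mult}(\emptyset)=1$. -}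

module Defs where

open import Data.Nat using (ℕ; zero; suc; _+_; _*_; _∸_; _≤?_; _<?_; _≟_; _!; NonZero)
open import Data.Nat.Properties using (_!≢0; m*n≢0; ≤-decTotalOrder)
open import Data.Nat.DivMod using (_/_)
open import Data.Bool using (Bool; true; false; if_then_else_; _∧_)
open import Data.Fin using (Fin; zero; suc)
open import Data.Vec using (Vec; lookup; toList; allFin)
open import Data.List using (List; []; _∷_; length; map; concatMap; applyUpTo; filter)
open import Data.Nat.ListAction using (sum; product)
import Data.List.Properties as LP
open import Data.List.Membership.Propositional using (_∈_)
open import Data.List.Relation.Unary.Unique.Propositional using (Unique)
open import Data.Product using (Σ; _×_; _,_; proj₁; proj₂; swap)
open import Function.Bundles using (_⇔_)
open import Relation.Nullary using (¬_; does)
open import Relation.Binary.PropositionalEquality using (_≡_; _≢_)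
open import Data.List.Sort.InsertionSort ≤-decTotalOrder using (sort)

countL : {A : Set} → (A → Bool) → List A → ℕ
countL p []       = 0
countL p (x ∷ xs) = if p x then suc (countL p xs) else countL p xs

HasSize : {X : Set} → (X → Set) → ℕ → Set
HasSize {X} P m =
  Σ (List X) λ L → Unique L × (∀ x → (x ∈ L) ⇔ P x) × length L ≡ m

record Graph : Set where
  field
    nV   : ℕ
    nE   : ℕ
    ends : Fin nE → Fin nV × Fin nV
open Graph public

-- An orientation chooses a direction for every edge:
-- true = (first endpoint → second endpoint), false = reversed.
Orientation : Graph → Set
Orientation G = Vec Bool (nE G)

arc : (G : Graph) → Orientation G → Fin (nE G) → Fin (nV G) × Fin (nV G)
arc G γ e = if lookup γ e then ends G e else swap (ends G e)

tl hd : (G : Graph) → Orientation G → Fin (nE G) → Fin (nV G)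
tl G γ e = proj₁ (arc G γ e)
hd G γ e = proj₂ (arc G γ e)

Chain : (G : Graph) → Orientation G → Fin (nV G) → List (Fin (nE G)) → Fin (nV G) → Set
Chain G γ u []       v = u ≡ v
Chain G γ u (e ∷ es) v = (tl G γ e ≡ u) × Chain G γ (hd G γ e) es v

DirectedCycle : (G : Graph) → Orientation G → Set
DirectedCycle G γ =
  Σ (Fin (nE G)) λ e → Σ (List (Fin (nE G))) λ es → Chain G γ (tl G γ e) (e ∷ es) (tl G γ e)

Acyclic : (G : Graph) → Orientation G → Set
Acyclic G γ = ¬ DirectedCycle G γ

-- A coloring assigns to each vertex a color; colors are ℕ
-- (color c here stands for the positive integer c+1; order is preserved).
Coloring : Graph → Set
Coloring G = Vec ℕ (nV G)

Proper : (G : Graph) → Coloring G → Set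
Proper G κ = ∀ e → lookup κ (proj₁ (ends G e)) ≢ lookup κ (proj₂ (ends G e))

asc : (G : Graph) → Orientation G → Coloring G → ℕ
asc G γ κ =
  countL (λ e → does (lookup κ (tl G γ e) <? lookup κ (hd G γ e))) (toList (allFin (nE G)))

content : (G : Graph) → Coloring G → ℕ → ℕ
content G κ j = countL (λ c → does (c ≟ j)) (toList κ)

-- an exponent vector (α₀, α₁, …, α_{N-1}, 0, 0, …) given as a list
expo : List ℕ → ℕ → ℕ
expo []       j       = 0
expo (a ∷ as) zero    = a
expo (a ∷ as) (suc j) = expo as j

HasMonomial : (G : Graph) → Coloring G → List ℕ → Set
HasMonomial G κ α = ∀ j → content G κ j ≡ expo α j

-- "the coefficient of q^k x^α in Tχ^o_G(q) = Σ_{γ acyclic} Σ_{κ proper}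
--  q^{asc^γ(κ)} x^κ  equals m"
TchiCoeff : Graph → List ℕ → ℕ → ℕ → Set
TchiCoeff G α k m =
  HasSize {Orientation G × Coloring G}
    (λ p → Acyclic G (proj₁ p) × Proper G (proj₂ p)
           × HasMonomial G (proj₂ p) α × asc G (proj₁ p) (proj₂ p) ≡ k)
    m

St : (n : ℕ) → .{{NonZero n}} → Graph
St (suc n) = record { nV = suc n ; nE = n ; ends = λ i → zero , suc i }

Poly : Set
Poly = ℕ → ℕ

_*P_ : Poly → Poly → Poly
(p *P r) k = sum (map (λ i → p i * r (k ∸ i)) (applyUpTo (λ i → i) (suc k)))

oneP : Poly
oneP zero    = 1
oneP (suc _) = 0

qPlus1 : Poly
qPlus1 zero          = 1
qPlus1 (suc zero)    = 1
qPlus1 (suc (suc _)) = 0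

_^P_ : Poly → ℕ → Poly
p ^P zero  = oneP
p ^P suc e = p *P (p ^P e)

listsOver : ℕ → ℕ → List (List ℕ)
listsOver n zero    = [] ∷ []
listsOver n (suc ℓ) = concatMap (λ x → map (x ∷_) (listsOver n ℓ)) (applyUpTo suc n)

nonincreasing : List ℕ → Bool
nonincreasing []           = true
nonincreasing (x ∷ [])     = true
nonincreasing (x ∷ y ∷ xs) = does (y ≤? x) ∧ nonincreasing (y ∷ xs)

-- partitions of n: nonincreasing lists of positive integers summing to n
-- (every part is ≤ n and there are ≤ n parts)
partitions : ℕ → List (List ℕ)
partitions n =
  filter (λ λ' → nonincreasing λ' Data.Bool.≟ true)
    (filter (λ λ' → sum λ' ≟ n)
      (concatMap (listsOver n) (applyUpTo (λ i → i) (suc n))))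

a₁ : List ℕ → ℕ
a₁ = countL (λ x → does (x ≟ 1))

dropLast : List ℕ → List ℕ
dropLast []           = []
dropLast (x ∷ [])     = []
dropLast (x ∷ y ∷ xs) = x ∷ dropLast (y ∷ xs)

prod!≢0 : (β : List ℕ) → NonZero (product (map _! β))
prod!≢0 []      = _
prod!≢0 (b ∷ β) = m*n≢0 (b !) (product (map _! β)) {{b !≢0}} {{prod!≢0 β}}

mult : List ℕ → ℕ
mult β = ((sum β) ! / product (map _! β)) {{prod!≢0 β}}

-- coefficient of x^α in m_λ : 1 if the nonzero exponents of α are a
-- rearrangement of the parts of λ, else 0
mCoeff : List ℕ → List ℕ → ℕ
mCoeff λ' α =
  if does (LP.≡-dec _≟_ (sort (filter (λ a → 1 ≤? a) α)) (sort λ')) then 1 else 0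

-- coefficient of q^k x^α in  Σ_{λ ⊢ n} a₁(λ) mult(λ̃) (q+1)^{n-1} m_λ
rhsCoeff : ℕ → List ℕ → ℕ → ℕ
rhsCoeff n α k =
  sum (map (λ λ' → a₁ λ' * mult (dropLast λ') * (qPlus1 ^P (n ∸ 1)) k * mCoeff λ' α)
           (partitions n))

-- Every orientation of a star is acyclic, and for a proper coloring each
-- edge is an ascent under exactly one of its two orientations; so, whatever
-- the coloring, the orientations with k ascents are counted by the
-- coefficient of q^k in (q+1)^(n-1). A proper coloring with content α gives
-- the root a color c used by no leaf, so α_c = 1, and the leaves form an
-- arbitrary word with content α - e_c: there are (n-1)!/∏ α_j! of them for
-- each of the a₁(α) choices of c. On the right only the partition λ formed by
-- the nonzero entries of α contributes; when a₁(λ) > 0 its last part is a 1,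
-- so mult(λ̃) is the same number (n-1)!/∏ λ_j!.
module Submission where

open import Defs
open import Data.Bool using (Bool; true; false; if_then_else_; not)
open import Data.Bool.Properties using (T-≡; T-∧) renaming (_≟_ to _≟ᴮ_)
open import Data.Empty using (⊥-elim)
open import Data.Fin using (Fin; zero; suc)
import Data.Fin.Properties as Fin
open import Data.List
  using (List; []; _∷_; length; map; _++_; applyUpTo; upTo; filter; concatMap)
open import Data.List.Properties
  using (length-map; length-++; map-applyUpTo; map-upTo; ∷-injective; ≡-dec)
open import Data.List.Membership.Propositional using (_∈_; find; lose)
open import Data.List.Membership.Propositional.Properties
  using ( ∈-map⁺; ∈-map⁻; ∈-++⁺ˡ; ∈-++⁺ʳ; ∈-++⁻; ∈-upTo⁺; ∈-applyUpTo⁺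
        ; ∈-filter⁺; ∈-filter⁻; ∈-concatMap⁺; ∈-concatMap⁻ )
open import Data.List.Relation.Binary.Disjoint.Propositional using (Disjoint)
open import Data.List.Relation.Binary.Permutation.Propositional
  using (_↭_; ↭⇒↭ₛ; ↭-refl; ↭-reflexive; ↭-sym; ↭-trans; ↭-prep; ↭-swap)
open import Data.List.Relation.Binary.Permutation.Propositional.Properties
  using (All-resp-↭; ↭-length; filter-↭)
import Data.List.Relation.Binary.Permutation.Propositional.Properties as ↭
open import Data.List.Relation.Binary.Pointwise using (Pointwise-≡⇒≡)
open import Data.List.Relation.Unary.All as All using (All; []; _∷_)
import Data.List.Relation.Unary.All.Properties as AllProp
open import Data.List.Relation.Unary.AllPairs as AllPairs using ([]; _∷_)
import Data.List.Relation.Unary.AllPairs.Properties as AllPairsProp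
open import Data.List.Relation.Unary.Any using (here; there)
open import Data.List.Relation.Unary.Linked using ([]; [-]; _∷_)
open import Data.List.Relation.Unary.Sorted.TotalOrder using (Sorted)
open import Data.List.Relation.Unary.Sorted.TotalOrder.Properties using (↗↭↗⇒≋)
open import Data.List.Relation.Unary.Unique.Propositional using (Unique)
import Data.List.Relation.Unary.Unique.Propositional.Properties as Unique
open import Data.Nat
  using ( ℕ; zero; suc; pred; _+_; _*_; _∸_; _!; _≤_; _<_; z≤n; s≤s
        ; _≟_; _<?_; _≤?_; NonZero; >-nonZero )
open import Data.Nat.DivMod using (_/_; /-congˡ; /-congʳ; m*n/n≡m)
open import Data.Nat.ListAction using (sum; product)
open import Data.Nat.ListAction.Properties using (sum-↭; product-↭)
open import Data.Nat.Properties
  using ( suc-injective; suc-pred; +-identityʳ; +-suc; +-comm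
        ; *-identityˡ; *-identityʳ; *-zeroʳ; *-comm; *-assoc; *-distribʳ-+
        ; m+n≡0⇒m≡0; m+n≡0⇒n≡0; ≤-antisym; ≤-trans; m≤m+n; m≤n+m; ≤ᵇ⇒≤
        ; <⇒≢; <-cmp; <-asym; ≤-totalOrder; ≤-decTotalOrder )
open import Data.Product using (_×_; _,_; proj₁; proj₂)
open import Data.Sum using (inj₁; inj₂)
open import Data.Vec using (Vec; []; _∷_; lookup; head; tail; toList; tabulate)
open import Data.List.Sort.InsertionSort ≤-decTotalOrder using (sort)
open import Data.List.Sort.InsertionSort.Properties ≤-decTotalOrder using (sort-↭; sort-↗)
open import Relation.Binary.Properties.DecTotalOrder ≤-decTotalOrder
  using (≥-decTotalOrder; ≥-totalOrder)
open import Data.List.Sort.InsertionSort ≥-decTotalOrder using () renaming (sort to sortDesc)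
open import Data.List.Sort.InsertionSort.Properties ≥-decTotalOrder
  using () renaming (sort-↭ to sortDesc-↭; sort-↗ to sortDesc-↘)
open import Function.Base using (_∘_; id; case_of_)
open import Function.Bundles using (_⇔_; mk⇔; Equivalence)
open import Function.Properties.Equivalence using () renaming (trans to ⇔-trans)
open import Relation.Binary.Definitions using (tri<; tri≈; tri>)
open import Relation.Binary.PropositionalEquality
open import Relation.Nullary using (¬_; does; yes; no)
open import Relation.Nullary.Decidable using (dec-true; dec-false; T?)

open Equivalence using (to; from)

private variable
  A B X : Set
  M m k : ℕ

≡suc⇒1≤ : ∀ {n m} → n ≡ suc m → 1 ≤ n
≡suc⇒1≤ refl = s≤s z≤n

∈⇒≤sum : ∀ {x xs} → x ∈ xs → x ≤ sum xs
∈⇒≤sum {xs = y ∷ xs} (here refl) = m≤m+n y (sum xs)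
∈⇒≤sum {xs = y ∷ xs} (there x∈)  = ≤-trans (∈⇒≤sum x∈) (m≤n+m (sum xs) y)

length≤sum : ∀ {xs} → All (1 ≤_) xs → length xs ≤ sum xs
length≤sum []                   = z≤n
length≤sum (s≤s z≤n ∷ positive) = s≤s (≤-trans (length≤sum positive) (m≤n+m _ _))

sum-map-const : (c : ℕ) (L : List A) → sum (map (λ _ → c) L) ≡ length L * c
sum-map-const c []      = refl
sum-map-const c (_ ∷ L) = cong (c +_) (sum-map-const c L)

sum-map-≡0 : (F : A → ℕ) {xs : List A} → (∀ {x} → x ∈ xs → F x ≡ 0) → sum (map F xs) ≡ 0
sum-map-≡0 F {[]}     _   = refl
sum-map-≡0 F {x ∷ xs} F≡0 = cong₂ _+_ (F≡0 (here refl)) (sum-map-≡0 F (F≡0 ∘ there))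

sum-map-single : (F : A → ℕ) {xs : List A} {x₀ : A} → Unique xs → x₀ ∈ xs →
  (∀ {x} → x ∈ xs → x ≢ x₀ → F x ≡ 0) → sum (map F xs) ≡ F x₀
sum-map-single F (x₀∉ ∷ _) (here refl) F≡0 =
  trans (cong (F _ +_) (sum-map-≡0 F (λ x∈ → F≡0 (there x∈) (All.lookup x₀∉ x∈ ∘ sym))))
        (+-identityʳ _)
sum-map-single F {x ∷ _} (x∉ ∷ unique) (there x₀∈) F≡0 =
  cong₂ _+_ (F≡0 (here refl) (All.lookup x∉ x₀∈)) (sum-map-single F unique x₀∈ (F≡0 ∘ there))

sum-applyUpTo-≡0 : (f : ℕ → ℕ) → (∀ i → f i ≡ 0) → ∀ n → sum (applyUpTo f n) ≡ 0
sum-applyUpTo-≡0 f f≡0 zero    = refl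
sum-applyUpTo-≡0 f f≡0 (suc n) = cong₂ _+_ (f≡0 0) (sum-applyUpTo-≡0 (f ∘ suc) (f≡0 ∘ suc) n)

sum-applyUpTo-cong : {f g : ℕ → ℕ} → (∀ i → f i ≡ g i) →
  ∀ n → sum (applyUpTo f n) ≡ sum (applyUpTo g n)
sum-applyUpTo-cong f≡g zero    = refl
sum-applyUpTo-cong f≡g (suc n) = cong₂ _+_ (f≡g 0) (sum-applyUpTo-cong (f≡g ∘ suc) n)

sum-applyUpTo-*ʳ : (f : ℕ → ℕ) (c n : ℕ) →
  sum (applyUpTo f n) * c ≡ sum (applyUpTo (λ i → f i * c) n)
sum-applyUpTo-*ʳ f c zero    = refl
sum-applyUpTo-*ʳ f c (suc n) =
  trans (*-distribʳ-+ c (f 0) _) (cong (f 0 * c +_) (sum-applyUpTo-*ʳ (f ∘ suc) c n))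

hasSize-cong : {P Q : X → Set} → (∀ x → P x ⇔ Q x) → HasSize P m → HasSize Q m
hasSize-cong P⇔Q (L , unique , L⇔P , len) =
  L , unique , (λ x → ⇔-trans (L⇔P x) (P⇔Q x)) , len

hasSize-∅ : {P : X → Set} → (∀ x → ¬ P x) → HasSize P 0
hasSize-∅ ¬P = [] , [] , (λ x → mk⇔ (λ ()) (⊥-elim ∘ ¬P x)) , refl

hasSize-singleton : {P : X → Set} (x₀ : X) → P x₀ → (∀ x → P x → x ≡ x₀) → HasSize P 1
hasSize-singleton x₀ Px₀ only =
  x₀ ∷ [] , [] ∷ [] , (λ x → mk⇔ (λ { (here refl) → Px₀ }) (here ∘ only x)) , refl

hasSize-bijection : {P : X → Set} {Q : A → Set} (f : A → X) (g : X → A) →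
  (∀ a → g (f a) ≡ a) → (∀ x → f (g x) ≡ x) →
  (∀ a → Q a → P (f a)) → (∀ x → P x → Q (g x)) → HasSize Q m → HasSize P m
hasSize-bijection {P = P} f g gf fg Q⇒P P⇒Q (L , unique , L⇔Q , len) =
  map f L , Unique.map⁺ f-injective unique , fL⇔P , trans (length-map f L) len
  where
  f-injective : ∀ {a b} → f a ≡ f b → a ≡ b
  f-injective {a} {b} fa≡fb = trans (sym (gf a)) (trans (cong g fa≡fb) (gf b))
  fL⇔P : ∀ x → (x ∈ map f L) ⇔ P x
  fL⇔P x = mk⇔ ∈⇒P (λ Px → subst (_∈ map f L) (fg x) (∈-map⁺ f (from (L⇔Q (g x)) (P⇒Q x Px))))
    where
    ∈⇒P : x ∈ map f L → P x
    ∈⇒P x∈ with a , a∈L , refl ← ∈-map⁻ f x∈ = Q⇒P a (to (L⇔Q a) a∈L)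

hasSize-Σ : {Q : A → B → Set} (J : List A) → Unique J → (f : A → ℕ) →
  (∀ a → a ∈ J → HasSize (Q a) (f a)) →
  HasSize {A × B} (λ (a , b) → a ∈ J × Q a b) (sum (map f J))
hasSize-Σ [] [] f count = hasSize-∅ λ _ ()
hasSize-Σ {Q = Q} (a ∷ J) (a∉J ∷ unique) f count
  with La , uniqueˡ , La⇔Qa , lenˡ ← count a (here refl)
     | L , uniqueʳ , L⇔ , lenʳ ← hasSize-Σ {Q = Q} J unique f (λ a′ → count a′ ∘ there)
  = map (a ,_) La ++ L
  , Unique.++⁺ (Unique.map⁺ (cong proj₂) uniqueˡ) uniqueʳ disjoint
  , member⇔
  , trans (length-++ (map (a ,_) La)) (cong₂ _+_ (trans (length-map _ La) lenˡ) lenʳ)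
  where
  disjoint : ∀ {v} → ¬ (v ∈ map (a ,_) La × v ∈ L)
  disjoint (v∈ˡ , v∈ʳ) with _ , _ , refl ← ∈-map⁻ (a ,_) v∈ˡ =
    All.lookup a∉J (proj₁ (to (L⇔ _) v∈ʳ)) refl
  member⇔ : ∀ p → (p ∈ map (a ,_) La ++ L) ⇔ (proj₁ p ∈ a ∷ J × Q (proj₁ p) (proj₂ p))
  member⇔ p = mk⇔ member→ →member
    where
    member→ : p ∈ map (a ,_) La ++ L → proj₁ p ∈ a ∷ J × Q (proj₁ p) (proj₂ p)
    member→ p∈ with ∈-++⁻ (map (a ,_) La) p∈
    ... | inj₂ p∈ʳ = let a′∈J , q = to (L⇔ p) p∈ʳ in there a′∈J , q
    ... | inj₁ p∈ˡ with b , b∈ , refl ← ∈-map⁻ (a ,_) p∈ˡ = here refl , to (La⇔Qa b) b∈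
    →member : proj₁ p ∈ a ∷ J × Q (proj₁ p) (proj₂ p) → p ∈ map (a ,_) La ++ L
    →member (here refl , q)  = ∈-++⁺ˡ (∈-map⁺ (a ,_) (from (La⇔Qa (proj₂ p)) q))
    →member (there a′∈J , q) = ∈-++⁺ʳ (map (a ,_) La) (from (L⇔ p) (a′∈J , q))

hasSize-∷ : {P : Vec A (suc M) → Set} (J : List A) → Unique J → (f : A → ℕ) →
  (∀ a w → P (a ∷ w) → a ∈ J) → (∀ a → a ∈ J → HasSize (λ w → P (a ∷ w)) (f a)) →
  HasSize P (sum (map f J))
hasSize-∷ J unique f head∈J count =
  hasSize-bijection (λ (a , w) → a ∷ w) (λ v → head v , tail v)
    (λ _ → refl) (λ { (_ ∷ _) → refl })
    (λ _ → proj₂) (λ { (a ∷ w) P → head∈J a w P , P })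
    (hasSize-Σ J unique f count)

hasSize-×-constFibre : {P : A → Set} {Q : A → B → Set} →
  HasSize P m → (∀ a → P a → HasSize (Q a) k) →
  HasSize {B × A} (λ (b , a) → P a × Q a b) (m * k)
hasSize-×-constFibre {m = m} {k} (L , unique , L⇔P , len) fibre =
  subst (HasSize _) (trans (sum-map-const k L) (cong (_* k) len))
    (hasSize-bijection (λ (a , b) → b , a) (λ (b , a) → a , b) (λ _ → refl) (λ _ → refl)
      (λ (a , _) (a∈L , Q) → to (L⇔P a) a∈L , Q)
      (λ (_ , a) (Pa , Q) → from (L⇔P a) Pa , Q)
      (hasSize-Σ L unique (λ _ → k) (λ a a∈L → fibre a (to (L⇔P a) a∈L))))

-- Orientations of the star

qTimes : Poly → Poly
qTimes p zero    = 0
qTimes p (suc k) = p k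

qPlus1-*P : (p : Poly) (k : ℕ) → (qPlus1 *P p) k ≡ p k + qTimes p k
qPlus1-*P p zero    = +-identityʳ (p 0 + 0)
qPlus1-*P p (suc k) =
  cong₂ _+_ (*-identityˡ (p (suc k)))
    (trans (cong (1 * p k +_) higherTerms≡0) (trans (+-identityʳ _) (*-identityˡ (p k))))
  where
  higherTerms≡0 : sum (map (λ i → qPlus1 i * p (suc k ∸ i)) (applyUpTo (2 +_) k)) ≡ 0
  higherTerms≡0 = trans (cong sum (map-applyUpTo _ _ k)) (sum-applyUpTo-≡0 _ (λ _ → refl) k)

-- The left side is sum (map _ (true ∷ false ∷ [])), as produced by splitting on a Boolean head.
qPlus1-*P-split : (p : Poly) (c : Bool) (k : ℕ) →
  (if c then qTimes p else p) k + ((if not c then qTimes p else p) k + 0) ≡ (qPlus1 *P p) k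
qPlus1-*P-split p true  k =
  trans (cong (qTimes p k +_) (+-identityʳ (p k)))
        (trans (+-comm (qTimes p k) (p k)) (sym (qPlus1-*P p k)))
qPlus1-*P-split p false k = trans (cong (p k +_) (+-identityʳ _)) (sym (qPlus1-*P p k))

hasSize-suc≡ : {C : X → ℕ} {p : Poly} → (∀ k → HasSize (λ x → C x ≡ k) (p k)) →
  ∀ k → HasSize (λ x → suc (C x) ≡ k) (qTimes p k)
hasSize-suc≡ count zero    = hasSize-∅ λ _ ()
hasSize-suc≡ count (suc k) = hasSize-cong (λ _ → mk⇔ (cong suc) suc-injective) (count k)

countFin : (Fin M → Bool) → ℕ
countFin {zero}  b = 0
countFin {suc M} b = if b zero then suc (countFin (b ∘ suc)) else countFin (b ∘ suc)

countFin-cong : {b b′ : Fin M → Bool} → (∀ e → b e ≡ b′ e) → countFin b ≡ countFin b′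
countFin-cong {zero}  b≡b′ = refl
countFin-cong {suc M} b≡b′ rewrite b≡b′ zero | countFin-cong (b≡b′ ∘ suc) = refl

countL-tabulate : (p : A → Bool) (f : Fin M → A) →
  countL p (toList (tabulate f)) ≡ countFin (p ∘ f)
countL-tabulate {M = zero}  p f = refl
countL-tabulate {M = suc M} p f rewrite countL-tabulate p (f ∘ suc) = refl

agree : Bool → Bool → Bool
agree true  c = c
agree false c = not c

agreements-hasSize : (x : Fin M → Bool) (k : ℕ) →
  HasSize (λ γ → countFin (λ e → agree (lookup γ e) (x e)) ≡ k) ((qPlus1 ^P M) k)
agreements-hasSize {zero}  x zero    = hasSize-singleton [] refl λ { [] _ → refl }
agreements-hasSize {zero}  x (suc k) = hasSize-∅ λ { [] () }
agreements-hasSize {suc M} x k =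
  subst (HasSize _) (qPlus1-*P-split (qPlus1 ^P M) (x zero) k)
    (hasSize-∷ (true ∷ false ∷ []) (((λ ()) ∷ []) ∷ [] ∷ []) fibreSize
      (λ { true _ _ → here refl ; false _ _ → there (here refl) })
      (λ b _ → fibre b))
  where
  fibreSize : Bool → ℕ
  fibreSize b = (if agree b (x zero) then qTimes (qPlus1 ^P M) else qPlus1 ^P M) k
  fibre : ∀ b → HasSize (λ γ → countFin (λ e → agree (lookup (b ∷ γ) e) (x e)) ≡ k) (fibreSize b)
  fibre b with agree b (x zero)
  ... | true  = hasSize-suc≡ (agreements-hasSize (x ∘ suc)) k
  ... | false = agreements-hasSize (x ∘ suc) k

module _ {N : ℕ} (γ : Orientation (St (suc N))) where

  arc-into-leaf : ∀ {u e es i} → Chain (St (suc N)) γ u (e ∷ es) (suc i) → lookup γ i ≡ true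
  arc-into-leaf {e = e} {es = []} (_ , hd≡leaf) with lookup γ e in γe
  ... | true  = trans (cong (lookup γ) (sym (Fin.suc-injective hd≡leaf))) γe
  ... | false with () ← hd≡leaf
  arc-into-leaf {es = _ ∷ _} (_ , chain) = arc-into-leaf chain

  -- A closed walk through a leaf must enter and leave it along its only edge.
  star-acyclic : Acyclic (St (suc N)) γ
  star-acyclic (e , es , _ , chain) with lookup γ e in γe
  star-acyclic (e , [] , _ , ()) | true
  star-acyclic (e , e′ ∷ _ , _ , tl≡leaf , _) | true with lookup γ e′ in γe′
  ... | true  with () ← tl≡leaf
  ... | false with refl ← Fin.suc-injective tl≡leaf with () ← trans (sym γe) γe′
  star-acyclic (e , [] , _ , ()) | false
  star-acyclic (e , _ ∷ _ , _ , chain) | false with () ← trans (sym γe) (arc-into-leaf chain)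

<?-swap : ∀ {m n} → m ≢ n → does (n <? m) ≡ not (does (m <? n))
<?-swap {m} {n} m≢n with <-cmp m n
... | tri< m<n _ _ rewrite dec-true  (m <? n) m<n         = dec-false (n <? m) (<-asym m<n)
... | tri≈ _ m≡n _                                        = ⊥-elim (m≢n m≡n)
... | tri> _ _ n<m rewrite dec-false (m <? n) (<-asym n<m) = dec-true (n <? m) n<m

asc-star : ∀ {N} (γ : Orientation (St (suc N))) c (w : Vec ℕ N) → Proper (St (suc N)) (c ∷ w) →
  asc (St (suc N)) γ (c ∷ w) ≡ countFin (λ e → agree (lookup γ e) (does (c <? lookup w e)))
asc-star {N} γ c w proper = trans (countL-tabulate isAscent id) (countFin-cong ascent-agrees)
  where
  κ : Coloring (St (suc N))
  κ = c ∷ w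
  isAscent : Fin N → Bool
  isAscent e = does (lookup κ (tl (St (suc N)) γ e) <? lookup κ (hd (St (suc N)) γ e))
  ascent-agrees : ∀ e → isAscent e ≡ agree (lookup γ e) (does (c <? lookup w e))
  ascent-agrees e with lookup γ e
  ... | true  = refl
  ... | false = <?-swap (proper e)

star-orientations-hasSize : ∀ {N} (κ : Coloring (St (suc N))) → Proper (St (suc N)) κ →
  ∀ k → HasSize (λ γ → asc (St (suc N)) γ κ ≡ k) ((qPlus1 ^P N) k)
star-orientations-hasSize (c ∷ w) proper k =
  hasSize-cong (λ γ → mk⇔ (trans (asc-star γ c w proper)) (trans (sym (asc-star γ c w proper))))
    (agreements-hasSize (λ e → does (c <? lookup w e)) k)

-- Words with prescribed content

occurrences : Vec ℕ M → ℕ → ℕ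
occurrences w j = countL (λ c → does (c ≟ j)) (toList w)

HasContent : Vec ℕ M → List ℕ → Set
HasContent w β = ∀ j → occurrences w j ≡ expo β j

occurrences-∷-≡ : (x : ℕ) (w : Vec ℕ M) → occurrences (x ∷ w) x ≡ suc (occurrences w x)
occurrences-∷-≡ x w rewrite dec-true (x ≟ x) refl = refl

occurrences-∷-≢ : ∀ {x j} (w : Vec ℕ M) → x ≢ j → occurrences (x ∷ w) j ≡ occurrences w j
occurrences-∷-≢ {x = x} {j} w x≢j rewrite dec-false (x ≟ j) x≢j = refl

absent⇒occurrences≡0 : ∀ {x} (w : Vec ℕ M) → (∀ e → x ≢ lookup w e) → occurrences w x ≡ 0
absent⇒occurrences≡0 []      absent = refl
absent⇒occurrences≡0 (y ∷ w) absent =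
  trans (occurrences-∷-≢ w (absent zero ∘ sym)) (absent⇒occurrences≡0 w (absent ∘ suc))

occurrences≡0⇒absent : ∀ {x} (w : Vec ℕ M) → occurrences w x ≡ 0 → ∀ e → x ≢ lookup w e
occurrences≡0⇒absent (y ∷ w) none zero refl with () ← trans (sym (occurrences-∷-≡ y w)) none
occurrences≡0⇒absent {x = x} (y ∷ w) none (suc e) with y ≟ x
... | yes refl with () ← trans (sym (occurrences-∷-≡ y w)) none
... | no y≢x = occurrences≡0⇒absent w (trans (sym (occurrences-∷-≢ w y≢x)) none) e

decrementAt : List ℕ → ℕ → List ℕ
decrementAt []      _       = []
decrementAt (a ∷ β) zero    = pred a ∷ β
decrementAt (a ∷ β) (suc x) = a ∷ decrementAt β x

expo-decrementAt-≡ : ∀ β x → expo (decrementAt β x) x ≡ pred (expo β x)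
expo-decrementAt-≡ []      x       = refl
expo-decrementAt-≡ (a ∷ β) zero    = refl
expo-decrementAt-≡ (a ∷ β) (suc x) = expo-decrementAt-≡ β x

expo-decrementAt-≢ : ∀ β {x j} → x ≢ j → expo (decrementAt β x) j ≡ expo β j
expo-decrementAt-≢ []      {x}     {j}     x≢j = refl
expo-decrementAt-≢ (a ∷ β) {zero}  {zero}  x≢j = ⊥-elim (x≢j refl)
expo-decrementAt-≢ (a ∷ β) {zero}  {suc j} x≢j = refl
expo-decrementAt-≢ (a ∷ β) {suc x} {zero}  x≢j = refl
expo-decrementAt-≢ (a ∷ β) {suc x} {suc j} x≢j = expo-decrementAt-≢ β (x≢j ∘ cong suc)

expo>0⇒<length : ∀ β {x} → 1 ≤ expo β x → x < length β
expo>0⇒<length []      ()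
expo>0⇒<length (a ∷ β) {zero}  _   = s≤s z≤n
expo>0⇒<length (a ∷ β) {suc x} pos = s≤s (expo>0⇒<length β pos)

sum≡0⇒expo≡0 : ∀ β → sum β ≡ 0 → ∀ j → expo β j ≡ 0
sum≡0⇒expo≡0 []      _     j       = refl
sum≡0⇒expo≡0 (a ∷ β) sum≡0 zero    = m+n≡0⇒m≡0 a sum≡0
sum≡0⇒expo≡0 (a ∷ β) sum≡0 (suc j) = sum≡0⇒expo≡0 β (m+n≡0⇒n≡0 a sum≡0) j

applyUpTo-expo : ∀ β → applyUpTo (expo β) (length β) ≡ β
applyUpTo-expo []      = refl
applyUpTo-expo (a ∷ β) = cong (a ∷_) (applyUpTo-expo β)

hasContent-∷ : ∀ x (w : Vec ℕ M) β →
  HasContent (x ∷ w) β ⇔ (1 ≤ expo β x × HasContent w (decrementAt β x))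
hasContent-∷ x w β = mk⇔ split join
  where
  split : HasContent (x ∷ w) β → 1 ≤ expo β x × HasContent w (decrementAt β x)
  split content = ≡suc⇒1≤ (sym x-count) , content′
    where
    x-count : suc (occurrences w x) ≡ expo β x
    x-count = trans (sym (occurrences-∷-≡ x w)) (content x)
    content′ : HasContent w (decrementAt β x)
    content′ j with x ≟ j
    ... | yes refl = trans (cong pred x-count) (sym (expo-decrementAt-≡ β x))
    ... | no x≢j   =
      trans (sym (occurrences-∷-≢ w x≢j)) (trans (content j) (sym (expo-decrementAt-≢ β x≢j)))
  join : 1 ≤ expo β x × HasContent w (decrementAt β x) → HasContent (x ∷ w) β
  join (pos , content′) j with x ≟ j
  ... | yes refl = begin
    occurrences (x ∷ w) x  ≡⟨ occurrences-∷-≡ x w ⟩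
    suc (occurrences w x)  ≡⟨ cong suc (trans (content′ x) (expo-decrementAt-≡ β x)) ⟩
    suc (pred (expo β x))  ≡⟨ suc-pred (expo β x) {{>-nonZero pos}} ⟩
    expo β x               ∎
    where open ≡-Reasoning
  ... | no x≢j = trans (occurrences-∷-≢ w x≢j) (trans (content′ j) (expo-decrementAt-≢ β x≢j))

whenPositive : ℕ → ℕ → ℕ
whenPositive zero    _ = 0
whenPositive (suc _) v = v

wordCount : ℕ → List ℕ → ℕ
wordCount zero    β = if does (sum β ≟ 0) then 1 else 0
wordCount (suc M) β =
  sum (applyUpTo (λ x → whenPositive (expo β x) (wordCount M (decrementAt β x))) (length β))

words-hasSize : ∀ β → HasSize {Vec ℕ M} (λ w → HasContent w β) (wordCount M β)
words-hasSize {zero} β with sum β ≟ 0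
... | yes sum≡0 rewrite dec-true (sum β ≟ 0) sum≡0 =
  hasSize-singleton [] (λ j → sym (sum≡0⇒expo≡0 β sum≡0 j)) λ { [] _ → refl }
... | no  sum≢0 rewrite dec-false (sum β ≟ 0) sum≢0 = hasSize-∅ λ { [] content → sum≢0 (begin
  sum β                                ≡⟨ cong sum (applyUpTo-expo β) ⟨
  sum (applyUpTo (expo β) (length β))  ≡⟨ sum-applyUpTo-≡0 (expo β) (sym ∘ content) (length β) ⟩
  0                                    ∎) }
  where open ≡-Reasoning
words-hasSize {suc M} β =
  subst (HasSize _) (cong sum (map-upTo fibreSize (length β)))
    (hasSize-∷ (upTo (length β)) (Unique.upTo⁺ (length β)) fibreSize
      (λ x w content → ∈-upTo⁺ (expo>0⇒<length β (proj₁ (to (hasContent-∷ x w β) content))))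
      (λ x _ → fibre x))
  where
  fibreSize : ℕ → ℕ
  fibreSize x = whenPositive (expo β x) (wordCount M (decrementAt β x))
  fibre : ∀ x → HasSize (λ w → HasContent (x ∷ w) β) (fibreSize x)
  fibre x with expo β x in βx
  ... | zero  = hasSize-∅ λ w content →
    case subst (1 ≤_) βx (proj₁ (to (hasContent-∷ x w β) content)) of λ ()
  ... | suc _ = hasSize-cong
    (λ w → mk⇔ (λ content′ → from (hasContent-∷ x w β) (≡suc⇒1≤ βx , content′))
               (proj₂ ∘ to (hasContent-∷ x w β)))
    (words-hasSize (decrementAt β x))

∏! : List ℕ → ℕ
∏! β = product (map _! β)

infixl 7 _/∏!_

_/∏!_ : ℕ → List ℕ → ℕ
m /∏! β = (m / ∏! β) {{prod!≢0 β}}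

sum≡0⇒∏!≡1 : ∀ β → sum β ≡ 0 → ∏! β ≡ 1
sum≡0⇒∏!≡1 []         _     = refl
sum≡0⇒∏!≡1 (zero ∷ β) sum≡0 = trans (+-identityʳ (∏! β)) (sum≡0⇒∏!≡1 β sum≡0)

sum-decrementAt : ∀ β {x} → 1 ≤ expo β x → suc (sum (decrementAt β x)) ≡ sum β
sum-decrementAt (suc a ∷ β) {zero}  _   = refl
sum-decrementAt (a ∷ β)     {suc x} pos =
  trans (sym (+-suc a _)) (cong (a +_) (sum-decrementAt β pos))

∏!-decrementAt : ∀ β {x} → 1 ≤ expo β x → ∏! β ≡ ∏! (decrementAt β x) * expo β x
∏!-decrementAt (suc a ∷ β) {zero}  _   = begin
  (suc a * a !) * ∏! β    ≡⟨ cong (_* ∏! β) (*-comm (suc a) (a !)) ⟩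
  (a ! * suc a) * ∏! β    ≡⟨ *-assoc (a !) (suc a) (∏! β) ⟩
  a ! * (suc a * ∏! β)    ≡⟨ cong (a ! *_) (*-comm (suc a) (∏! β)) ⟩
  a ! * (∏! β * suc a)    ≡⟨ *-assoc (a !) (∏! β) (suc a) ⟨
  (a ! * ∏! β) * suc a    ∎
  where open ≡-Reasoning
∏!-decrementAt (a ∷ β)     {suc x} pos =
  trans (cong (a ! *_) (∏!-decrementAt β pos)) (sym (*-assoc (a !) _ _))

wordCount-multinomial : ∀ β → sum β ≡ M → wordCount M β * ∏! β ≡ M !
wordCount-multinomial {zero} β sum≡0 rewrite dec-true (sum β ≟ 0) sum≡0 =
  trans (+-identityʳ (∏! β)) (sum≡0⇒∏!≡1 β sum≡0)
wordCount-multinomial {suc M} β sum≡1+M = begin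
  wordCount (suc M) β * ∏! β                             ≡⟨ sum-applyUpTo-*ʳ fibreSize (∏! β) (length β) ⟩
  sum (applyUpTo (λ x → fibreSize x * ∏! β) (length β)) ≡⟨ sum-applyUpTo-cong term (length β) ⟩
  sum (applyUpTo (λ x → expo β x * M !) (length β))      ≡⟨ sum-applyUpTo-*ʳ (expo β) (M !) (length β) ⟨
  sum (applyUpTo (expo β) (length β)) * M !              ≡⟨ cong (λ β′ → sum β′ * M !) (applyUpTo-expo β) ⟩
  sum β * M !                                            ≡⟨ cong (_* M !) sum≡1+M ⟩
  suc M * M !                                            ∎
  where
  open ≡-Reasoning
  fibreSize : ℕ → ℕ
  fibreSize x = whenPositive (expo β x) (wordCount M (decrementAt β x))
  term : ∀ x → fibreSize x * ∏! β ≡ expo β x * M !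
  term x with expo β x in βx
  ... | zero  = refl
  ... | suc e = begin
    wordCount M β′ * ∏! β                ≡⟨ cong (wordCount M β′ *_) (∏!-decrementAt β pos) ⟩
    wordCount M β′ * (∏! β′ * expo β x)  ≡⟨ *-assoc (wordCount M β′) (∏! β′) (expo β x) ⟨
    wordCount M β′ * ∏! β′ * expo β x    ≡⟨ cong₂ _*_ (wordCount-multinomial β′ sum≡M) βx ⟩
    M ! * suc e                          ≡⟨ *-comm (M !) (suc e) ⟩
    suc e * M !                          ∎
    where
    β′ : List ℕ
    β′ = decrementAt β x
    pos : 1 ≤ expo β x
    pos = ≡suc⇒1≤ βx
    sum≡M : sum β′ ≡ M
    sum≡M = suc-injective (trans (sum-decrementAt β pos) sum≡1+M)

wordCount-≡ : ∀ β → sum β ≡ M → wordCount M β ≡ M ! /∏! β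
wordCount-≡ {M} β sum≡M = sym (begin
  M ! /∏! β                     ≡⟨ /-congˡ {{prod!≢0 β}} (wordCount-multinomial β sum≡M) ⟨
  (wordCount M β * ∏! β) /∏! β  ≡⟨ m*n/n≡m (wordCount M β) (∏! β) {{prod!≢0 β}} ⟩
  wordCount M β                 ∎)
  where open ≡-Reasoning

wordCount-≢ : ∀ β → sum β ≢ M → wordCount M β ≡ 0
wordCount-≢ {zero}  β sum≢0 rewrite dec-false (sum β ≟ 0) sum≢0 = refl
wordCount-≢ {suc M} β sum≢1+M = sum-applyUpTo-≡0 _ term (length β)
  where
  term : ∀ x → whenPositive (expo β x) (wordCount M (decrementAt β x)) ≡ 0
  term x with expo β x in βx
  ... | zero  = refl
  ... | suc _ = wordCount-≢ (decrementAt β x) λ sum≡M →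
    sum≢1+M (trans (sym (sum-decrementAt β (≡suc⇒1≤ βx))) (cong suc sum≡M))

-- Proper colorings of the star

whenOne : ℕ → ℕ → ℕ
whenOne (suc zero) v = v
whenOne _          _ = 0

starColoringCount : ℕ → List ℕ → ℕ
starColoringCount N α =
  sum (applyUpTo (λ c → whenOne (expo α c) (wordCount N (decrementAt α c))) (length α))

starColoring-∷ : ∀ {N} c (w : Vec ℕ N) α →
  (Proper (St (suc N)) (c ∷ w) × HasContent (c ∷ w) α)
    ⇔ (expo α c ≡ 1 × HasContent w (decrementAt α c))
starColoring-∷ {N} c w α = mk⇔ split join
  where
  split : Proper (St (suc N)) (c ∷ w) × HasContent (c ∷ w) α →
    expo α c ≡ 1 × HasContent w (decrementAt α c)
  split (proper , content) = c-once , proj₂ (to (hasContent-∷ c w α) content)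
    where
    c-once : expo α c ≡ 1
    c-once = trans (sym (content c))
      (trans (occurrences-∷-≡ c w) (cong suc (absent⇒occurrences≡0 w proper)))
  join : expo α c ≡ 1 × HasContent w (decrementAt α c) →
    Proper (St (suc N)) (c ∷ w) × HasContent (c ∷ w) α
  join (c-once , content′) =
    occurrences≡0⇒absent w c-absent , from (hasContent-∷ c w α) (≡suc⇒1≤ c-once , content′)
    where
    c-absent : occurrences w c ≡ 0
    c-absent = trans (content′ c) (trans (expo-decrementAt-≡ α c) (cong pred c-once))

starColorings-hasSize : ∀ {N} α →
  HasSize (λ κ → Proper (St (suc N)) κ × HasMonomial (St (suc N)) κ α) (starColoringCount N α)
starColorings-hasSize {N} α =
  subst (HasSize _) (cong sum (map-upTo fibreSize (length α)))
    (hasSize-∷ (upTo (length α)) (Unique.upTo⁺ (length α)) fibreSize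
      (λ c w coloring → ∈-upTo⁺ (expo>0⇒<length α (≡suc⇒1≤ (c-once c w coloring))))
      (λ c _ → fibre c))
  where
  c-once : ∀ c w → Proper (St (suc N)) (c ∷ w) × HasContent (c ∷ w) α → expo α c ≡ 1
  c-once c w = proj₁ ∘ to (starColoring-∷ c w α)
  fibreSize : ℕ → ℕ
  fibreSize c = whenOne (expo α c) (wordCount N (decrementAt α c))
  fibre : ∀ c → HasSize (λ w → Proper (St (suc N)) (c ∷ w) × HasContent (c ∷ w) α) (fibreSize c)
  fibre c with expo α c in αc
  ... | 1           = hasSize-cong
    (λ w → mk⇔ (λ content′ → from (starColoring-∷ c w α) (αc , content′))
               (proj₂ ∘ to (starColoring-∷ c w α)))
    (words-hasSize (decrementAt α c))
  ... | 0           = hasSize-∅ λ w coloring → case trans (sym αc) (c-once c w coloring) of λ ()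
  ... | suc (suc _) = hasSize-∅ λ w coloring → case trans (sym αc) (c-once c w coloring) of λ ()

sum-whenOne : ∀ α (g : ℕ → ℕ) v → (∀ c → expo α c ≡ 1 → g c ≡ v) →
  sum (applyUpTo (λ c → whenOne (expo α c) (g c)) (length α)) ≡ a₁ α * v
sum-whenOne []                g v g≡v = refl
sum-whenOne (zero ∷ α)        g v g≡v = sum-whenOne α (g ∘ suc) v (g≡v ∘ suc)
sum-whenOne (suc zero ∷ α)    g v g≡v = cong₂ _+_ (g≡v 0 refl) (sum-whenOne α (g ∘ suc) v (g≡v ∘ suc))
sum-whenOne (suc (suc _) ∷ α) g v g≡v = sum-whenOne α (g ∘ suc) v (g≡v ∘ suc)

starColoringCount-≡ : ∀ {N} α → sum α ≡ suc N → starColoringCount N α ≡ a₁ α * (N ! /∏! α)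
starColoringCount-≡ {N} α sum≡1+N = sum-whenOne α _ (N ! /∏! α) leafWords
  where
  leafWords : ∀ c → expo α c ≡ 1 → wordCount N (decrementAt α c) ≡ N ! /∏! α
  leafWords c αc≡1 =
    trans (wordCount-≡ α′ (suc-injective (trans (sum-decrementAt α pos) sum≡1+N)))
          (/-congʳ {{prod!≢0 α′}} {{prod!≢0 α}} ∏!≡)
    where
    α′ : List ℕ
    α′ = decrementAt α c
    pos : 1 ≤ expo α c
    pos = ≡suc⇒1≤ αc≡1
    ∏!≡ : ∏! α′ ≡ ∏! α
    ∏!≡ = sym (trans (∏!-decrementAt α pos) (trans (cong (∏! α′ *_) αc≡1) (*-identityʳ (∏! α′))))

starColoringCount-≢ : ∀ {N} α → sum α ≢ suc N → starColoringCount N α ≡ 0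
starColoringCount-≢ {N} α sum≢1+N = sum-applyUpTo-≡0 _ term (length α)
  where
  term : ∀ c → whenOne (expo α c) (wordCount N (decrementAt α c)) ≡ 0
  term c with expo α c in αc
  ... | 0           = refl
  ... | suc (suc _) = refl
  ... | 1           = wordCount-≢ (decrementAt α c) λ sum≡N →
    sum≢1+N (trans (sym (sum-decrementAt α (≡suc⇒1≤ αc))) (cong suc sum≡N))

star-TchiCoeff : ∀ N α k → TchiCoeff (St (suc N)) α k (starColoringCount N α * (qPlus1 ^P N) k)
star-TchiCoeff N α k =
  hasSize-cong
    (λ (γ , κ) → mk⇔ (λ ((proper , content) , ascents) → star-acyclic γ , proper , content , ascents)
                     (λ (_ , proper , content , ascents) → (proper , content) , ascents))
    (hasSize-×-constFibre (starColorings-hasSize α)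
      (λ κ (proper , _) → star-orientations-hasSize κ proper k))

-- Partitions

concatMap-unique : (f : A → List B) {xs : List A} → Unique xs → (∀ x → Unique (f x)) →
  (∀ {x y} → x ≢ y → Disjoint (f x) (f y)) → Unique (concatMap f xs)
concatMap-unique f unique uniqueᶠ disjoint =
  Unique.concat⁺ (AllProp.map⁺ (All.tabulate λ {x} _ → uniqueᶠ x))
                 (AllPairsProp.map⁺ (AllPairs.map disjoint unique))

listsOver-unique : ∀ n ℓ → Unique (listsOver n ℓ)
listsOver-unique n zero    = [] ∷ []
listsOver-unique n (suc ℓ) =
  concatMap-unique (λ x → map (x ∷_) (listsOver n ℓ))
    (Unique.applyUpTo⁺₁ suc n (λ i<j _ → <⇒≢ i<j ∘ suc-injective))
    (λ x → Unique.map⁺ (proj₂ ∘ ∷-injective) (listsOver-unique n ℓ))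
    headsDiffer
  where
  headsDiffer : ∀ {x y} → x ≢ y →
    Disjoint (map (x ∷_) (listsOver n ℓ)) (map (y ∷_) (listsOver n ℓ))
  headsDiffer x≢y (v∈ˣ , v∈ʸ)
    with _ , _ , refl ← ∈-map⁻ _ v∈ˣ
    with _ , _ , v≡ ← ∈-map⁻ _ v∈ʸ = x≢y (proj₁ (∷-injective v≡))

∈-listsOver⁻ : ∀ n ℓ {xs} → xs ∈ listsOver n ℓ → length xs ≡ ℓ
∈-listsOver⁻ n zero    (here refl) = refl
∈-listsOver⁻ n (suc ℓ) xs∈
  with x , _ , xs∈′ ← find (∈-concatMap⁻ (λ x → map (x ∷_) (listsOver n ℓ)) {xs = applyUpTo suc n} xs∈)
  with _ , ys∈ , refl ← ∈-map⁻ (x ∷_) xs∈′ = cong suc (∈-listsOver⁻ n ℓ ys∈)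

∈-listsOver⁺ : ∀ n {xs} → All (λ x → 1 ≤ x × x ≤ n) xs → xs ∈ listsOver n (length xs)
∈-listsOver⁺ n []                          = here refl
∈-listsOver⁺ n ((s≤s z≤n , x≤n) ∷ bounded) =
  ∈-concatMap⁺ _ (lose (∈-applyUpTo⁺ suc x≤n) (∈-map⁺ _ (∈-listsOver⁺ n bounded)))

candidates : ℕ → List (List ℕ)
candidates n = concatMap (listsOver n) (upTo (suc n))

partitions-unique : ∀ n → Unique (partitions n)
partitions-unique n =
  Unique.filter⁺ (λ μ → nonincreasing μ ≟ᴮ true) (Unique.filter⁺ (λ μ → sum μ ≟ n)
    (concatMap-unique (listsOver n) (Unique.upTo⁺ (suc n)) (listsOver-unique n) lengthsDiffer))
  where
  lengthsDiffer : ∀ {ℓ ℓ′} → ℓ ≢ ℓ′ → Disjoint (listsOver n ℓ) (listsOver n ℓ′)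
  lengthsDiffer ℓ≢ℓ′ (v∈ , v∈′) = ℓ≢ℓ′ (trans (sym (∈-listsOver⁻ n _ v∈)) (∈-listsOver⁻ n _ v∈′))

Sorted≥ : List ℕ → Set
Sorted≥ = Sorted ≥-totalOrder

sorted≥-↭⇒≡ : ∀ {xs ys} → Sorted≥ xs → Sorted≥ ys → xs ↭ ys → xs ≡ ys
sorted≥-↭⇒≡ xs↘ ys↘ xs↭ys = Pointwise-≡⇒≡ (↗↭↗⇒≋ ≥-totalOrder xs↘ ys↘ (↭⇒↭ₛ xs↭ys))

nonincreasing⇒sorted≥ : ∀ xs → nonincreasing xs ≡ true → Sorted≥ xs
nonincreasing⇒sorted≥ []           _  = []
nonincreasing⇒sorted≥ (x ∷ [])     _  = [-]
nonincreasing⇒sorted≥ (x ∷ y ∷ xs) ni =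
  let y≤x , rest = to T-∧ (from T-≡ ni)
  in ≤ᵇ⇒≤ y x y≤x ∷ nonincreasing⇒sorted≥ (y ∷ xs) (to T-≡ rest)

sorted≥⇒nonincreasing : ∀ {xs} → Sorted≥ xs → nonincreasing xs ≡ true
sorted≥⇒nonincreasing []                         = refl
sorted≥⇒nonincreasing [-]                        = refl
sorted≥⇒nonincreasing {x ∷ y ∷ _} (y≤x ∷ sorted) rewrite dec-true (y ≤? x) y≤x =
  sorted≥⇒nonincreasing sorted

∈-partitions⁻ : ∀ n {λ′} → λ′ ∈ partitions n → Sorted≥ λ′ × sum λ′ ≡ n
∈-partitions⁻ n {λ′} λ′∈ =
  let λ′∈′ , ni = ∈-filter⁻ (λ μ → nonincreasing μ ≟ᴮ true)
                            {xs = filter (λ μ → sum μ ≟ n) (candidates n)} λ′∈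
  in nonincreasing⇒sorted≥ λ′ ni , proj₂ (∈-filter⁻ (λ μ → sum μ ≟ n) {xs = candidates n} λ′∈′)

∈-partitions⁺ : ∀ n {λ′} → Sorted≥ λ′ → All (1 ≤_) λ′ → sum λ′ ≡ n → λ′ ∈ partitions n
∈-partitions⁺ n {λ′} sorted positive sum≡n =
  ∈-filter⁺ (λ μ → nonincreasing μ ≟ᴮ true)
    (∈-filter⁺ (λ μ → sum μ ≟ n)
      (∈-concatMap⁺ (listsOver n) (lose length∈ (∈-listsOver⁺ n bounded))) sum≡n)
    (sorted≥⇒nonincreasing sorted)
  where
  length∈ : length λ′ ∈ upTo (suc n)
  length∈ = ∈-upTo⁺ (s≤s (subst (length λ′ ≤_) sum≡n (length≤sum positive)))
  bounded : All (λ x → 1 ≤ x × x ≤ n) λ′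
  bounded = All.tabulate λ x∈ → All.lookup positive x∈ , subst (_ ≤_) sum≡n (∈⇒≤sum x∈)

dropLast-↭ : ∀ {xs} → Sorted≥ xs → All (1 ≤_) xs → 1 ∈ xs → xs ↭ 1 ∷ dropLast xs
dropLast-↭ {_ ∷ []}     _              _                          (here refl) = ↭-refl
dropLast-↭ {x ∷ y ∷ ys} (y≤x ∷ sorted) (_ ∷ positive@(1≤y ∷ _)) one∈        =
  ↭-trans (↭-prep x (dropLast-↭ sorted positive (one∈tail one∈))) (↭-swap x 1 ↭-refl)
  where
  one∈tail : 1 ∈ x ∷ y ∷ ys → 1 ∈ y ∷ ys
  one∈tail (here refl)  = here (≤-antisym 1≤y y≤x)
  one∈tail (there one∈) = one∈

mult-dropLast : ∀ {N λ′} → Sorted≥ λ′ → All (1 ≤_) λ′ → 1 ∈ λ′ → sum λ′ ≡ suc N →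
  mult (dropLast λ′) ≡ N ! /∏! λ′
mult-dropLast {N} {λ′} sorted positive one∈ sum≡1+N =
  trans (/-congˡ {{prod!≢0 rest}} (cong _! sum≡N)) (/-congʳ {{prod!≢0 rest}} {{prod!≢0 λ′}} ∏!≡)
  where
  rest : List ℕ
  rest = dropLast λ′
  λ′↭ : λ′ ↭ 1 ∷ rest
  λ′↭ = dropLast-↭ sorted positive one∈
  sum≡N : sum rest ≡ N
  sum≡N = suc-injective (trans (sum-↭ (↭-sym λ′↭)) sum≡1+N)
  ∏!≡ : ∏! rest ≡ ∏! λ′
  ∏!≡ = trans (sym (+-identityʳ (∏! rest))) (product-↭ (↭.map⁺ _! (↭-sym λ′↭)))

-- The right-hand side

positiveParts : List ℕ → List ℕ
positiveParts = filter (1 ≤?_)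

sum-positiveParts : ∀ α → sum (positiveParts α) ≡ sum α
sum-positiveParts []          = refl
sum-positiveParts (zero ∷ α)  = sum-positiveParts α
sum-positiveParts (suc a ∷ α) = cong (suc a +_) (sum-positiveParts α)

∏!-positiveParts : ∀ α → ∏! (positiveParts α) ≡ ∏! α
∏!-positiveParts []          = refl
∏!-positiveParts (zero ∷ α)  = trans (∏!-positiveParts α) (sym (+-identityʳ (∏! α)))
∏!-positiveParts (suc a ∷ α) = cong (suc a ! *_) (∏!-positiveParts α)

a₁-positiveParts : ∀ α → a₁ (positiveParts α) ≡ a₁ α
a₁-positiveParts []                = refl
a₁-positiveParts (zero ∷ α)        = a₁-positiveParts α
a₁-positiveParts (suc zero ∷ α)    = cong suc (a₁-positiveParts α)
a₁-positiveParts (suc (suc _) ∷ α) = a₁-positiveParts α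

countL≡length-filter : (p : A → Bool) (xs : List A) → countL p xs ≡ length (filter (T? ∘ p) xs)
countL≡length-filter p []       = refl
countL≡length-filter p (x ∷ xs) with p x
... | true  = cong suc (countL≡length-filter p xs)
... | false = countL≡length-filter p xs

countL-↭ : (p : A → Bool) {xs ys : List A} → xs ↭ ys → countL p xs ≡ countL p ys
countL-↭ p {xs} {ys} xs↭ys = begin
  countL p xs                  ≡⟨ countL≡length-filter p xs ⟩
  length (filter (T? ∘ p) xs)  ≡⟨ ↭-length (filter-↭ (T? ∘ p) xs↭ys) ⟩
  length (filter (T? ∘ p) ys)  ≡⟨ countL≡length-filter p ys ⟨
  countL p ys                  ∎
  where open ≡-Reasoning

a₁>0⇒1∈ : ∀ xs → 1 ≤ a₁ xs → 1 ∈ xs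
a₁>0⇒1∈ (zero ∷ xs)        pos = there (a₁>0⇒1∈ xs pos)
a₁>0⇒1∈ (suc zero ∷ xs)    _   = here refl
a₁>0⇒1∈ (suc (suc _) ∷ xs) pos = there (a₁>0⇒1∈ xs pos)

-- The partition λ for which x^α occurs in m_λ.
shape : List ℕ → List ℕ
shape α = sortDesc (positiveParts α)

shape-↭ : ∀ α → shape α ↭ positiveParts α
shape-↭ α = sortDesc-↭ (positiveParts α)

shape-positive : ∀ α → All (1 ≤_) (shape α)
shape-positive α = All-resp-↭ (↭-sym (shape-↭ α)) (AllProp.all-filter (1 ≤?_) α)

sum-shape : ∀ α → sum (shape α) ≡ sum α
sum-shape α = trans (sum-↭ (shape-↭ α)) (sum-positiveParts α)

a₁-shape : ∀ α → a₁ (shape α) ≡ a₁ α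
a₁-shape α = trans (countL-↭ _ (shape-↭ α)) (a₁-positiveParts α)

shape-∈-partitions : ∀ {n} α → sum α ≡ n → shape α ∈ partitions n
shape-∈-partitions {n} α sum≡n =
  ∈-partitions⁺ n (sortDesc-↘ (positiveParts α)) (shape-positive α) (trans (sum-shape α) sum≡n)

∈-partitions-↭⇒shape : ∀ n α {λ′} → λ′ ∈ partitions n → λ′ ↭ positiveParts α → λ′ ≡ shape α
∈-partitions-↭⇒shape n α λ′∈ λ′↭ =
  sorted≥-↭⇒≡ (proj₁ (∈-partitions⁻ n λ′∈)) (sortDesc-↘ (positiveParts α))
    (↭-trans λ′↭ (↭-sym (shape-↭ α)))

sort-↭⇒≡ : ∀ {xs ys} → xs ↭ ys → sort xs ≡ sort ys
sort-↭⇒≡ {xs} {ys} xs↭ys = Pointwise-≡⇒≡ (↗↭↗⇒≋ ≤-totalOrder (sort-↗ xs) (sort-↗ ys)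
  (↭⇒↭ₛ (↭-trans (sort-↭ xs) (↭-trans xs↭ys (↭-sym (sort-↭ ys))))))

sort-≡⇒↭ : ∀ {xs ys} → sort xs ≡ sort ys → xs ↭ ys
sort-≡⇒↭ {xs} {ys} sorts≡ = ↭-trans (↭-sym (sort-↭ xs)) (↭-trans (↭-reflexive sorts≡) (sort-↭ ys))

mCoeff-↭ : ∀ {λ′ α} → λ′ ↭ positiveParts α → mCoeff λ′ α ≡ 1
mCoeff-↭ {λ′} {α} λ′↭
  rewrite dec-true (≡-dec _≟_ (sort (positiveParts α)) (sort λ′)) (sort-↭⇒≡ (↭-sym λ′↭)) = refl

mCoeff-≁ : ∀ {λ′ α} → ¬ (λ′ ↭ positiveParts α) → mCoeff λ′ α ≡ 0
mCoeff-≁ {λ′} {α} λ′≁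
  rewrite dec-false (≡-dec _≟_ (sort (positiveParts α)) (sort λ′)) (λ′≁ ∘ ↭-sym ∘ sort-≡⇒↭) = refl

rhsTerm : ℕ → List ℕ → ℕ → List ℕ → ℕ
rhsTerm n α k λ′ = a₁ λ′ * mult (dropLast λ′) * (qPlus1 ^P (n ∸ 1)) k * mCoeff λ′ α

rhsTerm-≁ : ∀ n α k λ′ → ¬ (λ′ ↭ positiveParts α) → rhsTerm n α k λ′ ≡ 0
rhsTerm-≁ n α k λ′ λ′≁ = trans (cong (weight *_) (mCoeff-≁ {λ′} {α} λ′≁)) (*-zeroʳ weight)
  where
  weight : ℕ
  weight = a₁ λ′ * mult (dropLast λ′) * (qPlus1 ^P (n ∸ 1)) k

a₁*mult-shape : ∀ {N} α → sum α ≡ suc N →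
  a₁ (shape α) * mult (dropLast (shape α)) ≡ a₁ α * (N ! /∏! α)
a₁*mult-shape {N} α sum≡1+N rewrite a₁-shape α with a₁ α in a₁α
... | zero  = refl
... | suc m = cong (suc m *_) (trans
  (mult-dropLast (sortDesc-↘ (positiveParts α)) (shape-positive α)
    (a₁>0⇒1∈ (shape α) (≡suc⇒1≤ (trans (a₁-shape α) a₁α))) (trans (sum-shape α) sum≡1+N))
  (/-congʳ {{prod!≢0 (shape α)}} {{prod!≢0 α}}
    (trans (product-↭ (↭.map⁺ _! (shape-↭ α))) (∏!-positiveParts α))))

rhsCoeff-≢ : ∀ {n} α k → sum α ≢ n → rhsCoeff n α k ≡ 0
rhsCoeff-≢ {n} α k sum≢n = sum-map-≡0 (rhsTerm n α k) λ {λ′} λ′∈ → rhsTerm-≁ n α k λ′ λ λ′↭ →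
  sum≢n (trans (sym (sum-positiveParts α)) (trans (sum-↭ (↭-sym λ′↭)) (proj₂ (∈-partitions⁻ n λ′∈))))

rhsCoeff-≡ : ∀ {N} α k → sum α ≡ suc N →
  rhsCoeff (suc N) α k ≡ a₁ α * (N ! /∏! α) * (qPlus1 ^P N) k
rhsCoeff-≡ {N} α k sum≡1+N = begin
  rhsCoeff (suc N) α k      ≡⟨ onlyShape ⟩
  weight * P * mCoeff λ′ α  ≡⟨ cong (weight * P *_) (mCoeff-↭ {λ′} {α} (shape-↭ α)) ⟩
  weight * P * 1            ≡⟨ *-identityʳ (weight * P) ⟩
  weight * P                ≡⟨ cong (_* P) (a₁*mult-shape α sum≡1+N) ⟩
  a₁ α * (N ! /∏! α) * P    ∎
  where
  open ≡-Reasoning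
  λ′ : List ℕ
  λ′ = shape α
  weight : ℕ
  weight = a₁ λ′ * mult (dropLast λ′)
  P : ℕ
  P = (qPlus1 ^P N) k
  onlyShape : rhsCoeff (suc N) α k ≡ rhsTerm (suc N) α k λ′
  onlyShape = sum-map-single (rhsTerm (suc N) α k) (partitions-unique (suc N))
    (shape-∈-partitions α sum≡1+N)
    λ {μ} μ∈ μ≢ → rhsTerm-≁ (suc N) α k μ (μ≢ ∘ ∈-partitions-↭⇒shape (suc N) α μ∈)

corollary4p5 : (n : ℕ) → .{{_ : NonZero n}} → (α : List ℕ) → (k : ℕ) →
    TchiCoeff (St n) α k (rhsCoeff n α k)
corollary4p5 (suc N) α k = subst (TchiCoeff (St (suc N)) α k) counts-agree (star-TchiCoeff N α k)
  where
  counts-agree : starColoringCount N α * (qPlus1 ^P N) k ≡ rhsCoeff (suc N) α k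
  counts-agree with sum α ≟ suc N
  ... | yes sum≡1+N = trans (cong (_* (qPlus1 ^P N) k) (starColoringCount-≡ α sum≡1+N))
                            (sym (rhsCoeff-≡ α k sum≡1+N))
  ... | no  sum≢1+N = trans (cong (_* (qPlus1 ^P N) k) (starColoringCount-≢ α sum≢1+N))
                            (sym (rhsCoeff-≢ α k sum≢1+N))
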